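{- Let $A\in\mathbb{N}^{k\times k}$. Then for any $v\in[k]$ the function $f:\mathbb{N}\to\mathbb{N}$, $f(n)=(A^n)_{vv}$, has one of the following properties: (1) $f(n)=0$ for all $n\in\mathbb{N}\setminus\{0\}$ and $f(0)=1$; (2) there is $p\in\mathbb{N}\setminus\{0\}$ such that $f(n)=\mathbb{1}_{n\equiv 0\pmod p}$ for all $n\in\mathbb{N}$; (3) there are $p\in\mathbb{N}\setminus\{0\}$ and a function $g\in 2^{\Theta(n)}$ such that $f(n)=\mathbb{1}_{n\equiv0\pmod p}\cdot g(n)$ for all $n\in\mathbb{N}$.
   Context: $\mathbb{N}=\{0,1,2,\dots\}$, $[k]=\{1,\dots,k\}$. $\mathbb{1}_{n\equiv0\pmod p}$ is $1$ if $p$ divides $n$ and $0$ otherwise. $g\in 2^{\Theta(n)}$ means there are constants $0<\gamma_1\le\gamma_2$ and $N$ with $2^{\gamma_1 n}\le g(n)\le 2^{\gamma_2 n}$ for all $n\ge N$. -}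

module Defs where

open import Data.Nat using (ℕ; zero; suc; _+_; _*_; _^_; _≤_; _<_; _%_; NonZero)
open import Data.Fin using (Fin; _≟_)
open import Data.Product using (Σ; _×_; ∃)
open import Relation.Nullary using (yes; no)

Mat : ℕ → Set
Mat k = Fin k → Fin k → ℕ

sumFin : ∀ {k} → (Fin k → ℕ) → ℕ
sumFin {zero}  f = 0
sumFin {suc k} f = f Fin.zero + sumFin (λ j → f (Fin.suc j))

_⊗_ : ∀ {k} → Mat k → Mat k → Mat k
(A ⊗ B) i j = sumFin (λ l → A i l * B l j)

identity : ∀ {k} → Mat k
identity i j with i ≟ j
... | yes _ = 1
... | no  _ = 0

matPow : ∀ {k} → Mat k → ℕ → Mat k
matPow A zero    = identity
matPow A (suc n) = matPow A n ⊗ A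

ind : (p : ℕ) → .{{NonZero p}} → ℕ → ℕ
ind p n with n % p
... | zero  = 1
... | suc _ = 0

-- g ∈ 2^{Θ(n)}: there are rational constants 0 < γ₁ = a₁/b₁ ≤ γ₂ = a₂/b₂
-- and N with 2^{γ₁ n} ≤ g n ≤ 2^{γ₂ n} for all n ≥ N.
-- For γ = a/b with b ≥ 1, 2^{γ n} ≤ x  ⇔  2^{a n} ≤ x^b  and
-- x ≤ 2^{γ n}  ⇔  x^b ≤ 2^{a n}.
-- (Restricting real constants to rationals loses nothing: shrink γ₁ / enlarge γ₂.)
Exp2Theta : (ℕ → ℕ) → Set
Exp2Theta g =
  Σ ℕ λ a₁ → Σ ℕ λ b₁ → Σ ℕ λ a₂ → Σ ℕ λ b₂ → Σ ℕ λ N →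
    (1 ≤ a₁) × (1 ≤ b₁) × (1 ≤ b₂) × (a₁ * b₂ ≤ a₂ * b₁) ×
    (∀ n → N ≤ n → (2 ^ (a₁ * n) ≤ g n ^ b₁) × (g n ^ b₂ ≤ 2 ^ (a₂ * n)))

-- The diagonal entry f n = (A ^ n) v v counts weighted closed walks at v, so f 0 = 1 and f is
-- supermultiplicative; in particular its support is an additive submonoid of ℕ.  Saturating the
-- entries of row v of A ^ n at 2 yields an eventually periodic sequence in a finite set, so whether
-- f n ≥ 2 for some n, whether f (n + 1) ≥ 1 for some n, and the least gap of the support are all
-- found by a finite search.  If f ≤ 1, splitting closed walks at their last
-- visit to v gives f (n + 1) = Σ_{a ≤ n} f a · r (n − a), where r counts first returns; then r is a
-- single 1 at some length p and f is the indicator of pℕ.  If some f c ≥ 2, the support lies in pℕ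
-- for its least gap p and contains all large multiples of p, and f (q c + m) ≥ 2 ^ q f m together
-- with f n ≤ C ^ n gives growth 2^Θ(n) on pℕ.

module Submission where

open import Defs
open import Data.Empty using (⊥; ⊥-elim)
open import Data.Fin using (Fin; _≟_; toℕ; funToFin; finToFun)
import Data.Fin as F
open import Data.Fin.Patterns using (0F; 1F; 2F)
import Data.Fin.Properties as FP
open import Data.Nat using (ℕ; zero; suc; _+_; _*_; _^_; _≤_; _<_; _∸_; _%_; _/_; _<?_; _≤?_; z≤n; s≤s; NonZero; >-nonZero)
open import Data.Nat.DivMod
open import Data.Nat.Divisibility using (_∣_; divides; m%n≡0⇒n∣m; n∣m⇒m%n≡0; ∣m+n∣m⇒∣n; ∣-trans; n∣m*n)
open import Data.Nat.Induction using (<-rec)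
open import Data.Nat.Properties hiding (_≟_)
open import Data.Nat.Tactic.RingSolver using (solve-∀)
open import Data.Product using (Σ; _×_; _,_; proj₁; proj₂)
open import Data.Sum using (_⊎_; inj₁; inj₂)
open import Function using (_∘_)
open import Relation.Binary using (tri<; tri≈; tri>)
open import Relation.Binary.PropositionalEquality
open import Relation.Nullary using (¬_; Dec; yes; no)
open import Relation.Nullary.Decidable using (_×-dec_)
open import Relation.Unary using (Decidable)
open import Algebra.Properties.Semiring.Sum +-*-semiring
  using (sum; sum-cong-≗; ∑-comm; ∑-distrib-+; *-distribˡ-sum; *-distribʳ-sum)

sumFin≡sum : ∀ {k} (h : Fin k → ℕ) → sumFin h ≡ sum h
sumFin≡sum {zero}  h = refl
sumFin≡sum {suc k} h = cong (h F.zero +_) (sumFin≡sum (λ l → h (F.suc l)))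

sumFin-cong : ∀ {k} {h h′ : Fin k → ℕ} → (∀ l → h l ≡ h′ l) → sumFin h ≡ sumFin h′
sumFin-cong {zero}  h≗h′ = refl
sumFin-cong {suc k} h≗h′ = cong₂ _+_ (h≗h′ F.zero) (sumFin-cong (λ l → h≗h′ (F.suc l)))

sumFin-mono-≤ : ∀ {k} {h h′ : Fin k → ℕ} → (∀ l → h l ≤ h′ l) → sumFin h ≤ sumFin h′
sumFin-mono-≤ {zero}  h≤h′ = z≤n
sumFin-mono-≤ {suc k} h≤h′ = +-mono-≤ (h≤h′ F.zero) (sumFin-mono-≤ (λ l → h≤h′ (F.suc l)))

≤-sumFin : ∀ {k} (h : Fin k → ℕ) l → h l ≤ sumFin h
≤-sumFin h F.zero    = m≤m+n _ _
≤-sumFin h (F.suc l) = ≤-trans (≤-sumFin (λ l → h (F.suc l)) l) (m≤n+m _ _)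

sumFin-zero : ∀ {k} {h : Fin k → ℕ} → (∀ l → h l ≡ 0) → sumFin h ≡ 0
sumFin-zero {zero}  h≡0 = refl
sumFin-zero {suc k} h≡0 = cong₂ _+_ (h≡0 F.zero) (sumFin-zero (λ l → h≡0 (F.suc l)))

sumFin-single : ∀ {k} (h : Fin k → ℕ) j → (∀ l → l ≢ j → h l ≡ 0) → sumFin h ≡ h j
sumFin-single {suc k} h F.zero h≡0 =
  trans (cong (h F.zero +_) (sumFin-zero (λ l → h≡0 (F.suc l) (λ ())))) (+-identityʳ _)
sumFin-single {suc k} h (F.suc j) h≡0 =
  cong₂ _+_ (h≡0 F.zero (λ ())) (sumFin-single (λ l → h (F.suc l)) j (λ l l≢j → h≡0 (F.suc l) (l≢j ∘ FP.suc-injective)))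

*-distribˡ-sumFin : ∀ {k} c (h : Fin k → ℕ) → c * sumFin h ≡ sumFin (λ l → c * h l)
*-distribˡ-sumFin c h = begin
  c * sumFin h           ≡⟨ cong (c *_) (sumFin≡sum h) ⟩
  c * sum h              ≡⟨ *-distribˡ-sum c h ⟩
  sum (λ l → c * h l)    ≡⟨ sumFin≡sum (λ l → c * h l) ⟨
  sumFin (λ l → c * h l) ∎
  where open ≡-Reasoning

*-distribʳ-sumFin : ∀ {k} c (h : Fin k → ℕ) → sumFin h * c ≡ sumFin (λ l → h l * c)
*-distribʳ-sumFin c h = begin
  sumFin h * c           ≡⟨ cong (_* c) (sumFin≡sum h) ⟩
  sum h * c              ≡⟨ *-distribʳ-sum c h ⟩
  sum (λ l → h l * c)    ≡⟨ sumFin≡sum (λ l → h l * c) ⟨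
  sumFin (λ l → h l * c) ∎
  where open ≡-Reasoning

sumFin-*ˡ-factor : ∀ {k} a (b c : Fin k → ℕ) → sumFin (λ l → a * b l * c l) ≡ a * sumFin (λ l → b l * c l)
sumFin-*ˡ-factor a b c =
  trans (sumFin-cong (λ l → *-assoc a (b l) (c l))) (sym (*-distribˡ-sumFin a (λ l → b l * c l)))

sumFin-distrib-+ : ∀ {k} (h h′ : Fin k → ℕ) → sumFin (λ l → h l + h′ l) ≡ sumFin h + sumFin h′
sumFin-distrib-+ h h′ = begin
  sumFin (λ l → h l + h′ l) ≡⟨ sumFin≡sum (λ l → h l + h′ l) ⟩
  sum (λ l → h l + h′ l)    ≡⟨ ∑-distrib-+ h h′ ⟩
  sum h + sum h′            ≡⟨ cong₂ _+_ (sumFin≡sum h) (sumFin≡sum h′) ⟨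
  sumFin h + sumFin h′      ∎
  where open ≡-Reasoning

sumFin-comm : ∀ {k m} (h : Fin k → Fin m → ℕ) →
  sumFin (λ i → sumFin (h i)) ≡ sumFin (λ j → sumFin (λ i → h i j))
sumFin-comm h = begin
  sumFin (λ i → sumFin (h i))          ≡⟨ sumFin≡sum (λ i → sumFin (h i)) ⟩
  sum (λ i → sumFin (h i))             ≡⟨ sum-cong-≗ (λ i → sumFin≡sum (h i)) ⟩
  sum (λ i → sum (h i))                ≡⟨ ∑-comm h ⟩
  sum (λ j → sum (λ i → h i j))        ≡⟨ sum-cong-≗ (λ j → sumFin≡sum (λ i → h i j)) ⟨
  sum (λ j → sumFin (λ i → h i j))     ≡⟨ sumFin≡sum (λ j → sumFin (λ i → h i j)) ⟨
  sumFin (λ j → sumFin (λ i → h i j))  ∎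
  where open ≡-Reasoning

identity-diag : ∀ {k} (i : Fin k) → identity i i ≡ 1
identity-diag i with i ≟ i
... | yes _   = refl
... | no  i≢i = ⊥-elim (i≢i refl)

identity-offdiag : ∀ {k} {i j : Fin k} → i ≢ j → identity i j ≡ 0
identity-offdiag {i = i} {j} i≢j with i ≟ j
... | yes i≡j = ⊥-elim (i≢j i≡j)
... | no  _   = refl

identity-≤1 : ∀ {k} (i j : Fin k) → identity i j ≤ 1
identity-≤1 i j with i ≟ j
... | yes _ = ≤-refl
... | no  _ = z≤n

⊗-identityʳ : ∀ {k} (A : Mat k) i j → (A ⊗ identity) i j ≡ A i j
⊗-identityʳ A i j = begin
  sumFin (λ l → A i l * identity l j) ≡⟨ sumFin-single _ j off-diagonal ⟩
  A i j * identity j j                ≡⟨ cong (A i j *_) (identity-diag j) ⟩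
  A i j * 1                           ≡⟨ *-identityʳ (A i j) ⟩
  A i j                               ∎
  where
  open ≡-Reasoning
  off-diagonal : ∀ l → l ≢ j → A i l * identity l j ≡ 0
  off-diagonal l l≢j = trans (cong (A i l *_) (identity-offdiag l≢j)) (*-zeroʳ (A i l))

⊗-congˡ : ∀ {k} {A B : Mat k} → (∀ i j → A i j ≡ B i j) → ∀ C i j → (A ⊗ C) i j ≡ (B ⊗ C) i j
⊗-congˡ A≡B C i j = sumFin-cong (λ l → cong (_* C l j) (A≡B i l))

⊗-assoc : ∀ {k} (A B C : Mat k) i j → ((A ⊗ B) ⊗ C) i j ≡ (A ⊗ (B ⊗ C)) i j
⊗-assoc A B C i j = begin
  sumFin (λ l → sumFin (λ m → A i m * B m l) * C l j)
    ≡⟨ sumFin-cong (λ l → *-distribʳ-sumFin (C l j) (λ m → A i m * B m l)) ⟩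
  sumFin (λ l → sumFin (λ m → A i m * B m l * C l j))
    ≡⟨ sumFin-comm (λ l m → A i m * B m l * C l j) ⟩
  sumFin (λ m → sumFin (λ l → A i m * B m l * C l j))
    ≡⟨ sumFin-cong (λ m → sumFin-cong (λ l → *-assoc (A i m) (B m l) (C l j))) ⟩
  sumFin (λ m → sumFin (λ l → A i m * (B m l * C l j)))
    ≡⟨ sumFin-cong (λ m → *-distribˡ-sumFin (A i m) (λ l → B m l * C l j)) ⟨
  sumFin (λ m → A i m * sumFin (λ l → B m l * C l j))
    ∎
  where open ≡-Reasoning

matPow-+ : ∀ {k} (A : Mat k) m n i j → matPow A (m + n) i j ≡ (matPow A m ⊗ matPow A n) i j
matPow-+ A m zero    i j = trans (cong (λ x → matPow A x i j) (+-identityʳ m)) (sym (⊗-identityʳ (matPow A m) i j))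
matPow-+ A m (suc n) i j = begin
  matPow A (m + suc n) i j                 ≡⟨ cong (λ x → matPow A x i j) (+-suc m n) ⟩
  (matPow A (m + n) ⊗ A) i j               ≡⟨ ⊗-congˡ (matPow-+ A m n) A i j ⟩
  ((matPow A m ⊗ matPow A n) ⊗ A) i j      ≡⟨ ⊗-assoc (matPow A m) (matPow A n) A i j ⟩
  (matPow A m ⊗ matPow A (suc n)) i j      ∎
  where open ≡-Reasoning

matPow-diag-supermultiplicative : ∀ {k} (A : Mat k) v m n →
  matPow A m v v * matPow A n v v ≤ matPow A (m + n) v v
matPow-diag-supermultiplicative A v m n =
  ≤-trans (≤-sumFin (λ l → matPow A m v l * matPow A n l v) v) (≤-reflexive (sym (matPow-+ A m n v v)))

matPow-≤-^ : ∀ {k} (A : Mat k) C → (∀ j → sumFin (λ l → A l j) ≤ C) → ∀ n i j → matPow A n i j ≤ C ^ n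
matPow-≤-^ A C colSum≤C zero    i j = identity-≤1 i j
matPow-≤-^ A C colSum≤C (suc n) i j = begin
  sumFin (λ l → matPow A n i l * A l j) ≤⟨ sumFin-mono-≤ (λ l → *-monoˡ-≤ (A l j) (matPow-≤-^ A C colSum≤C n i l)) ⟩
  sumFin (λ l → C ^ n * A l j)          ≡⟨ *-distribˡ-sumFin (C ^ n) (λ l → A l j) ⟨
  C ^ n * sumFin (λ l → A l j)          ≤⟨ *-monoʳ-≤ (C ^ n) (colSum≤C j) ⟩
  C ^ n * C                             ≡⟨ *-comm (C ^ n) C ⟩
  C ^ suc n                             ∎
  where open ≤-Reasoning

-- Saturation and eventual periodicity

-- Saturation at 2: sat (x + y) and sat (x * a) depend only on sat x and sat y, so the saturated
-- row v of A ^ n determines the saturated row v of A ^ (n + 1).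
sat : ℕ → Fin 3
sat zero          = 0F
sat (suc zero)    = 1F
sat (suc (suc _)) = 2F

sat-≥2 : ∀ {x} → 2 ≤ x → sat x ≡ 2F
sat-≥2 (s≤s (s≤s _)) = refl

sat-idem : ∀ x → sat (toℕ (sat x)) ≡ sat x
sat-idem zero          = refl
sat-idem (suc zero)    = refl
sat-idem (suc (suc _)) = refl

sat-+ : ∀ x y → sat (x + y) ≡ sat (toℕ (sat x) + toℕ (sat y))
sat-+ zero          y             = sym (sat-idem y)
sat-+ (suc zero)    zero          = refl
sat-+ (suc zero)    (suc zero)    = refl
sat-+ (suc zero)    (suc (suc _)) = refl
sat-+ (suc (suc _)) _             = refl

sat-* : ∀ x a → sat (x * a) ≡ sat (toℕ (sat x) * a)
sat-* zero          _       = refl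
sat-* (suc zero)    _       = refl
sat-* (suc (suc x)) zero    = cong sat (*-zeroʳ (suc (suc x)))
sat-* (suc (suc x)) (suc a) =
  trans (sat-≥2 (≤-trans (s≤s (s≤s z≤n)) (m≤m*n (suc (suc x)) (suc a)))) (sym (sat-≥2 (m≤m*n 2 (suc a))))

sat-cong-+ : ∀ {x x′ y y′} → sat x ≡ sat x′ → sat y ≡ sat y′ → sat (x + y) ≡ sat (x′ + y′)
sat-cong-+ {x} {x′} {y} {y′} x≈x′ y≈y′ = begin
  sat (x + y)                       ≡⟨ sat-+ x y ⟩
  sat (toℕ (sat x) + toℕ (sat y))   ≡⟨ cong₂ (λ a b → sat (toℕ a + toℕ b)) x≈x′ y≈y′ ⟩
  sat (toℕ (sat x′) + toℕ (sat y′)) ≡⟨ sat-+ x′ y′ ⟨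
  sat (x′ + y′)                     ∎
  where open ≡-Reasoning

sat-cong-* : ∀ {x x′} a → sat x ≡ sat x′ → sat (x * a) ≡ sat (x′ * a)
sat-cong-* {x} {x′} a x≈x′ = begin
  sat (x * a)              ≡⟨ sat-* x a ⟩
  sat (toℕ (sat x) * a)    ≡⟨ cong (λ b → sat (toℕ b * a)) x≈x′ ⟩
  sat (toℕ (sat x′) * a)   ≡⟨ sat-* x′ a ⟨
  sat (x′ * a)             ∎
  where open ≡-Reasoning

sat-cong-sumFin : ∀ {k} {h h′ : Fin k → ℕ} → (∀ l → sat (h l) ≡ sat (h′ l)) → sat (sumFin h) ≡ sat (sumFin h′)
sat-cong-sumFin {zero}  h≈h′ = refl
sat-cong-sumFin {suc k} h≈h′ = sat-cong-+ (h≈h′ F.zero) (sat-cong-sumFin (λ l → h≈h′ (F.suc l)))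

sat-1≤ : ∀ {x y} → sat x ≡ sat y → 1 ≤ x → 1 ≤ y
sat-1≤ {suc zero}    {suc _} _  _ = s≤s z≤n
sat-1≤ {suc (suc _)} {suc _} _  _ = s≤s z≤n
sat-1≤ {suc zero}    {zero}  () _
sat-1≤ {suc (suc _)} {zero}  () _

sat-2≤ : ∀ {x y} → sat x ≡ sat y → 2 ≤ x → 2 ≤ y
sat-2≤ {suc zero}                  _  (s≤s ())
sat-2≤ {suc (suc _)} {suc (suc _)} _  _ = s≤s (s≤s z≤n)
sat-2≤ {suc (suc _)} {zero}        () _
sat-2≤ {suc (suc _)} {suc zero}    () _

funToFin-cong : ∀ {m n} {g h : Fin m → Fin n} → (∀ i → g i ≡ h i) → funToFin g ≡ funToFin h
funToFin-cong {zero}  g≗h = refl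
funToFin-cong {suc m} g≗h = cong₂ F.combine (g≗h F.zero) (funToFin-cong (λ i → g≗h (F.suc i)))

shift-≡ : ∀ {A : Set} (s : ℕ → A) → (∀ {m n} → s m ≡ s n → s (suc m) ≡ s (suc n)) →
  ∀ {m n} t → s m ≡ s n → s (t + m) ≡ s (t + n)
shift-≡ s step zero    sm≡sn = sm≡sn
shift-≡ s step (suc t) sm≡sn = step (shift-≡ s step t sm≡sn)

eventually-periodic : ∀ {N} (s : ℕ → Fin N) → (∀ {m n} → s m ≡ s n → s (suc m) ≡ s (suc n)) →
  Σ ℕ λ i → Σ ℕ λ j → i < j × (∀ t → s (t + i) ≡ s (t + j))
eventually-periodic {N} s step with FP.pigeonhole (n<1+n N) (λ i → s (toℕ i))
... | i , j , i<j , si≡sj = toℕ i , toℕ j , i<j , λ t → shift-≡ s step t si≡sj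

descend : {Q : ℕ → Set} (i j : ℕ) → i < j → (∀ t → Q (t + j) → Q (t + i)) →
  ∀ n → Q n → Σ ℕ λ n′ → n′ < j × Q n′
descend {Q} i j i<j back = <-rec (λ n → Q n → Below) step
  where
  Below : Set
  Below = Σ ℕ λ n′ → n′ < j × Q n′
  step : ∀ n → (∀ {m} → m < n → Q m → Below) → Q n → Below
  step n rec Qn with n <? j
  ... | yes n<j = n , n<j , Qn
  ... | no  n≮j = rec t+i<n (back t (subst Q (sym t+j≡n) Qn))
    where
    t = n ∸ j
    t+j≡n : t + j ≡ n
    t+j≡n = m∸n+n≡m (≮⇒≥ n≮j)
    t+i<n : t + i < n
    t+i<n = subst (t + i <_) t+j≡n (+-monoʳ-< t i<j)

least : {P : ℕ → Set} → Decidable P → ∀ {n} → P n → Σ ℕ λ m → P m × (∀ {m′} → m′ < m → ¬ P m′)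
least {P} P? {n} = <-rec (λ n → P n → Least) step n
  where
  Least : Set
  Least = Σ ℕ λ m → P m × (∀ {m′} → m′ < m → ¬ P m′)
  step : ∀ n → (∀ {m} → m < n → P m → Least) → P n → Least
  step n rec Pn with anyUpTo? P? n
  ... | yes (m , m<n , Pm) = rec m<n Pm
  ... | no  nothing-below  = n , Pn , λ m′<n Pm′ → nothing-below (_ , m′<n , Pm′)

-- Convolution

-- conv f g n = Σ_{a ≤ n} f a * g (n ∸ a), unfolded by peeling off the term a = n.
conv : (ℕ → ℕ) → (ℕ → ℕ) → ℕ → ℕ
conv f g zero    = f 0 * g 0
conv f g (suc n) = f (suc n) * g 0 + conv f (λ m → g (suc m)) n

conv-congʳ : ∀ f {g g′} n → (∀ m → g m ≡ g′ m) → conv f g n ≡ conv f g′ n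
conv-congʳ f zero    g≗g′ = cong (f 0 *_) (g≗g′ 0)
conv-congʳ f (suc n) g≗g′ = cong₂ _+_ (cong (f (suc n) *_) (g≗g′ 0)) (conv-congʳ f n (λ m → g≗g′ (suc m)))

conv-zeroʳ : ∀ f {g} n → (∀ m → g m ≡ 0) → conv f g n ≡ 0
conv-zeroʳ f n g≡0 = trans (conv-congʳ f n g≡0) (zero-for n)
  where
  zero-for : ∀ n → conv f (λ _ → 0) n ≡ 0
  zero-for zero    = *-zeroʳ (f 0)
  zero-for (suc n) = cong₂ _+_ (*-zeroʳ (f (suc n))) (zero-for n)

sumFin-conv : ∀ {k} f (G : Fin k → ℕ → ℕ) (c : Fin k → ℕ) n →
  sumFin (λ l → conv f (G l) n * c l) ≡ conv f (λ m → sumFin (λ l → G l m * c l)) n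
sumFin-conv f G c zero    = sumFin-*ˡ-factor (f 0) (λ l → G l 0) c
sumFin-conv f G c (suc n) = begin
  sumFin (λ l → (f (suc n) * G l 0 + conv f (G′ l) n) * c l)
    ≡⟨ sumFin-cong (λ l → *-distribʳ-+ (c l) (f (suc n) * G l 0) (conv f (G′ l) n)) ⟩
  sumFin (λ l → f (suc n) * G l 0 * c l + conv f (G′ l) n * c l)
    ≡⟨ sumFin-distrib-+ (λ l → f (suc n) * G l 0 * c l) (λ l → conv f (G′ l) n * c l) ⟩
  sumFin (λ l → f (suc n) * G l 0 * c l) + sumFin (λ l → conv f (G′ l) n * c l)
    ≡⟨ cong₂ _+_ (sumFin-*ˡ-factor (f (suc n)) (λ l → G l 0) c) (sumFin-conv f G′ c n) ⟩
  f (suc n) * sumFin (λ l → G l 0 * c l) + conv f (λ m → sumFin (λ l → G′ l m * c l)) n ∎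
  where
  open ≡-Reasoning
  G′ : Fin _ → ℕ → ℕ
  G′ l m = G l (suc m)

conv-top : ∀ f g n → f n * g 0 ≤ conv f g n
conv-top f g zero    = ≤-refl
conv-top f g (suc n) = m≤m+n _ _

≤-conv : ∀ f g a b → f a * g b ≤ conv f g (b + a)
≤-conv f g a zero    = conv-top f g a
≤-conv f g a (suc b) = ≤-trans (≤-conv f (λ m → g (suc m)) a b) (m≤n+m _ _)

≤-conv₂ : ∀ f g a d b → f a * g (b + suc d) + f (suc d + a) * g b ≤ conv f g (b + (suc d + a))
≤-conv₂ f g a d zero    = begin
  f a * g (suc d) + f (suc d + a) * g 0 ≡⟨ +-comm (f a * g (suc d)) _ ⟩
  f (suc d + a) * g 0 + f a * g (suc d) ≤⟨ +-monoʳ-≤ (f (suc d + a) * g 0) (≤-conv f (λ m → g (suc m)) a d) ⟩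
  conv f g (suc d + a)                  ∎
  where open ≤-Reasoning
≤-conv₂ f g a d (suc b) = ≤-trans (≤-conv₂ f (λ m → g (suc m)) a d b) (m≤n+m _ _)

conv-singleʳ : ∀ f {g} q n → (∀ m → m ≢ q → g m ≡ 0) → conv f g (q + n) ≡ f n * g q
conv-singleʳ f zero    zero    g≡0 = refl
conv-singleʳ f zero    (suc n) g≡0 =
  trans (cong (f (suc n) * _ +_) (conv-zeroʳ f n (λ m → g≡0 (suc m) (λ ())))) (+-identityʳ _)
conv-singleʳ f (suc q) n       g≡0 =
  cong₂ _+_ (trans (cong (f (suc q + n) *_) (g≡0 0 (λ ()))) (*-zeroʳ (f (suc q + n))))
            (conv-singleʳ f q n (λ m m≢q → g≡0 (suc m) (m≢q ∘ suc-injective)))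

conv-singleˡ : ∀ f g n → (∀ t → 0 < t → t ≤ n → f t ≡ 0) → conv f g n ≡ f 0 * g n
conv-singleˡ f g zero    f≡0 = refl
conv-singleˡ f g (suc n) f≡0 =
  cong₂ _+_ (cong (_* g 0) (f≡0 (suc n) (s≤s z≤n) ≤-refl))
            (conv-singleˡ f (λ m → g (suc m)) n (λ t 0<t t≤n → f≡0 t 0<t (m≤n⇒m≤1+n t≤n)))

-- Additive submonoids of ℕ and supermultiplicative sequences

%≤/ : ∀ m u .{{_ : NonZero u}} → u * u ≤ m → m % u ≤ m / u
%≤/ m u u*u≤m = ≤-trans (<⇒≤ (m%n<n m u)) (≤-trans (≤-reflexive (sym (m*n/n≡m u u))) (/-monoˡ-≤ u u*u≤m))

module AdditiveSubmonoid (S : ℕ → Set) (S-0 : S 0) (S-+ : ∀ x y → S x → S y → S (x + y)) where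

  S-* : ∀ n {x} → S x → S (n * x)
  S-* zero    _  = S-0
  S-* (suc n) Sx = S-+ _ _ Sx (S-* n Sx)

  S-span : ∀ {b d} → S b → S (b + d) → ∀ {s w} → w ≤ s → S (s * b + w * d)
  S-span {b} {d} Sb Sb+d {s} {w} w≤s with e , w+e≡s ← m≤n⇒∃[o]m+o≡n w≤s =
    subst S (trans (rearrange e w b d) (cong (λ s → s * b + w * d) w+e≡s)) (S-+ _ _ (S-* e Sb) (S-* w Sb+d))
    where
    rearrange : ∀ e w b d → e * b + w * (b + d) ≡ (w + e) * b + w * d
    rearrange = solve-∀

  module MinimalGap (p : ℕ) .{{_ : NonZero p}} (gap : ∀ a d → 0 < d → d < p → S a → S (a + d) → ⊥)
                    (a : ℕ) (Sa : S a) (Sa+p : S (a + p)) where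

    S⇒∣ : ∀ {x} → S x → p ∣ x
    S⇒∣ {x} Sx with x % p in x%p≡ρ
    ... | zero  = m%n≡0⇒n∣m x p x%p≡ρ
    ... | suc ρ = ⊥-elim (gap _ _ (s≤s z≤n) (subst (_< p) x%p≡ρ (m%n<n x p)) (S-* q Sa+p)
                                (subst S shifted (S-+ _ _ (S-* q Sa) Sx)))
      where
      q = x / p
      rearrange : ∀ q a p r → q * a + (r + q * p) ≡ q * (a + p) + r
      rearrange = solve-∀
      shifted : q * a + x ≡ q * (a + p) + suc ρ
      shifted = begin
        q * a + x                   ≡⟨ cong (q * a +_) (m≡m%n+[m/n]*n x p) ⟩
        q * a + (x % p + q * p)     ≡⟨ rearrange q a p (x % p) ⟩
        q * (a + p) + x % p         ≡⟨ cong (q * (a + p) +_) x%p≡ρ ⟩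
        q * (a + p) + suc ρ         ∎
        where open ≡-Reasoning

    large-multiples : Σ ℕ λ N → ∀ {n} → N ≤ n → p ∣ n → S n
    large-multiples with divides t a≡t*p ← S⇒∣ Sa = u * u * p , multiple
      where
      -- Unlike a = t p, the element b = u p of S has u ≥ 1, as dividing by u below requires.
      u = suc (t + t)
      b = a + (a + p)
      Sb : S b
      Sb = S-+ _ _ Sa Sa+p
      Sb+p : S (b + p)
      Sb+p = subst S (rearrange a p) (S-+ _ _ Sa+p Sa+p)
        where
        rearrange : ∀ a p → a + p + (a + p) ≡ a + (a + p) + p
        rearrange = solve-∀
      b≡u*p : b ≡ u * p
      b≡u*p = trans (cong (λ a → a + (a + p)) a≡t*p) (rearrange t p)
        where
        rearrange : ∀ t p → t * p + (t * p + p) ≡ suc (t + t) * p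
        rearrange = solve-∀
      multiple : ∀ {n} → u * u * p ≤ n → p ∣ n → S n
      multiple {n} N≤n (divides m n≡m*p) = subst S (sym n≡) (S-span Sb Sb+p (%≤/ m u u*u≤m))
        where
        u*u≤m : u * u ≤ m
        u*u≤m = *-cancelʳ-≤ (u * u) m p (subst (u * u * p ≤_) n≡m*p N≤n)
        rearrange : ∀ s u p w → s * (u * p) + w * p ≡ (w + s * u) * p
        rearrange = solve-∀
        n≡ : n ≡ m / u * b + m % u * p
        n≡ = begin
          n                              ≡⟨ n≡m*p ⟩
          m * p                          ≡⟨ cong (_* p) (m≡m%n+[m/n]*n m u) ⟩
          (m % u + m / u * u) * p        ≡⟨ rearrange (m / u) u p (m % u) ⟨
          m / u * (u * p) + m % u * p    ≡⟨ cong (λ b → m / u * b + m % u * p) b≡u*p ⟨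
          m / u * b + m % u * p          ∎
          where open ≡-Reasoning

module Supermultiplicative (g : ℕ → ℕ) (g-0 : 1 ≤ g 0) (g-super : ∀ m n → g m * g n ≤ g (m + n)) where

  2^-≤ : ∀ {c} → 2 ≤ g c → ∀ q → 2 ^ q ≤ g (q * c)
  2^-≤ 2≤gc zero        = g-0
  2^-≤ {c} 2≤gc (suc q) = ≤-trans (*-mono-≤ 2≤gc (2^-≤ 2≤gc q)) (g-super c (q * c))

  -- Write n = q c + m with N ≤ m < N + c; then g n ≥ g(c)^q g(m) ≥ 2^q, and n ≤ 2 q c.
  exponential-lower-bound : ∀ {p c N} → 0 < c → 2 ≤ g c → p ∣ c → (∀ {m} → N ≤ m → p ∣ m → 1 ≤ g m) →
    ∀ {n} → 2 * (N + c) ≤ n → p ∣ n → 2 ^ n ≤ g n ^ (2 * c)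
  exponential-lower-bound {p} {c} {N} 0<c 2≤gc p∣c g-pos {n} 2[N+c]≤n p∣n = begin
    2 ^ n              ≤⟨ ^-monoʳ-≤ 2 n≤q*2c ⟩
    2 ^ (q * (2 * c))  ≡⟨ ^-*-assoc 2 q (2 * c) ⟨
    (2 ^ q) ^ (2 * c)  ≤⟨ ^-monoˡ-≤ (2 * c) 2^q≤gn ⟩
    g n ^ (2 * c)      ∎
    where
    open ≤-Reasoning
    instance _ = >-nonZero 0<c
    D = n ∸ N
    q = D / c
    m = N + D % c
    N≤n : N ≤ n
    N≤n = ≤-trans (≤-trans (m≤m+n N c) (m≤m+n (N + c) (N + c + 0))) 2[N+c]≤n
    n≡qc+m : q * c + m ≡ n
    n≡qc+m = begin-equality
      q * c + (N + D % c)  ≡⟨ rearrange (q * c) N (D % c) ⟩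
      N + (D % c + q * c)  ≡⟨ cong (N +_) (m≡m%n+[m/n]*n D c) ⟨
      N + D                ≡⟨ m+[n∸m]≡n N≤n ⟩
      n                    ∎
      where
      rearrange : ∀ x N r → x + (N + r) ≡ N + (r + x)
      rearrange = solve-∀
    m<N+c : m < N + c
    m<N+c = +-monoʳ-< N (m%n<n D c)
    p∣m : p ∣ m
    p∣m = ∣m+n∣m⇒∣n (subst (p ∣_) (sym n≡qc+m) p∣n) (∣-trans p∣c (n∣m*n q))
    2^q≤gn : 2 ^ q ≤ g n
    2^q≤gn = begin
      2 ^ q              ≡⟨ *-identityʳ (2 ^ q) ⟨
      2 ^ q * 1          ≤⟨ *-mono-≤ (2^-≤ 2≤gc q) (g-pos (m≤m+n N (D % c)) p∣m) ⟩
      g (q * c) * g m    ≤⟨ g-super (q * c) m ⟩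
      g (q * c + m)      ≡⟨ cong g n≡qc+m ⟩
      g n                ∎
    N+c<qc : N + c < q * c
    N+c<qc = +-cancelˡ-< (N + c) (N + c) (q * c) (begin-strict
      (N + c) + (N + c)  ≡⟨ cong ((N + c) +_) (+-identityʳ (N + c)) ⟨
      2 * (N + c)        ≤⟨ 2[N+c]≤n ⟩
      n                  ≡⟨ n≡qc+m ⟨
      q * c + m          <⟨ +-monoʳ-< (q * c) m<N+c ⟩
      q * c + (N + c)    ≡⟨ +-comm (q * c) (N + c) ⟩
      (N + c) + q * c    ∎)
    n≤q*2c : n ≤ q * (2 * c)
    n≤q*2c = begin
      n                  ≡⟨ n≡qc+m ⟨
      q * c + m          ≤⟨ +-monoʳ-≤ (q * c) (<⇒≤ (<-trans m<N+c N+c<qc)) ⟩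
      q * c + q * c      ≡⟨ rearrange q c ⟩
      q * (2 * c)        ∎
      where
      rearrange : ∀ q c → q * c + q * c ≡ q * (2 * c)
      rearrange = solve-∀

n<2^n : ∀ n → n < 2 ^ n
n<2^n zero    = s≤s z≤n
n<2^n (suc n) = subst (suc (suc n) ≤_) (cong (2 ^ n +_) (sym (+-identityʳ (2 ^ n))))
                      (+-mono-≤ (m^n>0 2 n) (n<2^n n))

periodic-% : ∀ (f : ℕ → ℕ) p .{{_ : NonZero p}} → (∀ n → f (n + p) ≡ f n) → ∀ n → f n ≡ f (n % p)
periodic-% f p f-periodic n = trans (cong f (m≡m%n+[m/n]*n n p)) (shifted (n % p) (n / p))
  where
  rearrange : ∀ r q p → r + (p + q * p) ≡ r + q * p + p
  rearrange = solve-∀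
  shifted : ∀ r q → f (r + q * p) ≡ f r
  shifted r zero    = cong f (+-identityʳ r)
  shifted r (suc q) = trans (cong f (rearrange r q p)) (trans (f-periodic (r + q * p)) (shifted r q))

ind-periodic : ∀ (f : ℕ → ℕ) p .{{_ : NonZero p}} → f 0 ≡ 1 → (∀ {t} → 0 < t → t < p → f t ≡ 0) →
  (∀ n → f (n + p) ≡ f n) → ∀ n → f n ≡ ind p n
ind-periodic f p f0≡1 f-gap f-periodic n with n % p | periodic-% f p f-periodic n | m%n<n n p
... | zero  | fn≡f0 | _   = trans fn≡f0 f0≡1
... | suc r | fn≡fr | r<p = trans fn≡fr (f-gap (s≤s z≤n) r<p)

ind-factor : ∀ (f : ℕ → ℕ) p .{{_ : NonZero p}} b a N → 0 < b → 0 < a →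
  (∀ {n} → ¬ p ∣ n → f n ≡ 0) →
  (∀ {n} → N ≤ n → p ∣ n → 2 ^ n ≤ f n ^ b × f n ≤ 2 ^ (a * n)) →
  Σ (ℕ → ℕ) λ g → Exp2Theta g × (∀ n → f n ≡ ind p n * g n)
ind-factor f p b a N 0<b 0<a f-off f-bounds =
  g , (1 , b , a , 1 , N , ≤-refl , 0<b , ≤-refl , *-mono-≤ 0<a 0<b , g-bounds) , f≡ind*g
  where
  instance
    a≢0 = >-nonZero 0<a
    b≢0 = >-nonZero 0<b
  -- Off the multiples of p, g is an arbitrary function of the right growth.
  g : ℕ → ℕ
  g n with n % p
  ... | zero  = f n
  ... | suc _ = 2 ^ n
  g-bounds : ∀ n → N ≤ n → (2 ^ (1 * n) ≤ g n ^ b) × (g n ^ 1 ≤ 2 ^ (a * n))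
  g-bounds n N≤n with n % p in n%p≡
  ... | zero  with lower , upper ← f-bounds N≤n (m%n≡0⇒n∣m n p n%p≡) =
    subst (λ e → 2 ^ e ≤ f n ^ b) (sym (*-identityˡ n)) lower , subst (_≤ 2 ^ (a * n)) (sym (*-identityʳ (f n))) upper
  ... | suc _ =
    subst (2 ^ (1 * n) ≤_) (sym (^-*-assoc 2 n b)) (^-monoʳ-≤ 2 (subst (_≤ n * b) (sym (*-identityˡ n)) (m≤m*n n b))) ,
    subst (_≤ 2 ^ (a * n)) (sym (*-identityʳ (2 ^ n))) (^-monoʳ-≤ 2 (m≤n*m n a))
  f≡ind*g : ∀ n → f n ≡ ind p n * g n
  f≡ind*g n with n % p in n%p≡
  ... | zero  = sym (+-identityʳ (f n))
  ... | suc _ = f-off (λ p∣n → 0≢1+n (trans (sym (n∣m⇒m%n≡0 n p p∣n)) n%p≡))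

-- Closed walks at a vertex

module ClosedWalks {k} (A : Mat k) (v : Fin k) where

  f : ℕ → ℕ
  f n = matPow A n v v

  f-0 : f 0 ≡ 1
  f-0 = identity-diag v

  f-super : ∀ m n → f m * f n ≤ f (m + n)
  f-super = matPow-diag-supermultiplicative A v

  C : ℕ
  C = suc (sumFin (λ i → sumFin (A i)))

  f-≤-2^ : ∀ n → f n ≤ 2 ^ (C * n)
  f-≤-2^ n = begin
    f n           ≤⟨ matPow-≤-^ A C colSum≤C n v v ⟩
    C ^ n         ≤⟨ ^-monoˡ-≤ n (<⇒≤ (n<2^n C)) ⟩
    (2 ^ C) ^ n   ≡⟨ ^-*-assoc 2 C n ⟩
    2 ^ (C * n)   ∎
    where
    open ≤-Reasoning
    colSum≤C : ∀ j → sumFin (λ l → A l j) ≤ C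
    colSum≤C j = m≤n⇒m≤1+n (sumFin-mono-≤ (λ l → ≤-sumFin (A l) j))

  rowPattern : ℕ → Fin k → Fin 3
  rowPattern n l = sat (matPow A n v l)

  rowPattern-suc : ∀ {m n} → (∀ l → rowPattern m l ≡ rowPattern n l) →
                   ∀ l → rowPattern (suc m) l ≡ rowPattern (suc n) l
  rowPattern-suc m≈n l = sat-cong-sumFin (λ x → sat-cong-* (A x l) (m≈n x))

  rowCode : ℕ → Fin (3 ^ k)
  rowCode n = funToFin (rowPattern n)

  rowCode-injective : ∀ {m n} → rowCode m ≡ rowCode n → ∀ l → rowPattern m l ≡ rowPattern n l
  rowCode-injective {m} {n} m≡n l = begin
    rowPattern m l             ≡⟨ FP.finToFun-funToFin (rowPattern m) l ⟨
    finToFun (rowCode m) l     ≡⟨ cong (λ c → finToFun c l) m≡n ⟩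
    finToFun (rowCode n) l     ≡⟨ FP.finToFun-funToFin (rowPattern n) l ⟩
    rowPattern n l             ∎
    where open ≡-Reasoning

  private
    period : Σ ℕ λ i → Σ ℕ λ j → i < j × (∀ t → rowCode (t + i) ≡ rowCode (t + j))
    period = eventually-periodic rowCode
      (λ {m} {n} m≡n → funToFin-cong (rowPattern-suc {m} {n} (rowCode-injective {m} {n} m≡n)))

  i j : ℕ
  i = proj₁ period
  j = proj₁ (proj₂ period)

  i<j : i < j
  i<j = proj₁ (proj₂ (proj₂ period))

  sat-f-back : ∀ t → sat (f (t + j)) ≡ sat (f (t + i))
  sat-f-back t = sym (rowCode-injective {t + i} {t + j} (proj₂ (proj₂ (proj₂ period)) t) v)

  descend-f : {Q : ℕ → Set} → (∀ t → Q (t + j) → Q (t + i)) → ∀ n → Q n → Σ ℕ λ n′ → n′ < j × Q n′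
  descend-f = descend i j i<j

  -- avoiding m l is the weight of the walks v → l of length m that do not revisit v after time 0.
  avoiding : ℕ → Fin k → ℕ
  avoiding zero    l = identity v l
  avoiding (suc m) l with l ≟ v
  ... | yes _ = 0
  ... | no  _ = sumFin (λ x → avoiding m x * A x l)

  avoiding-suc-v : ∀ m → avoiding (suc m) v ≡ 0
  avoiding-suc-v m with v ≟ v
  ... | yes _   = refl
  ... | no  v≢v = ⊥-elim (v≢v refl)

  avoiding-suc-≢ : ∀ m {l} → l ≢ v → avoiding (suc m) l ≡ sumFin (λ x → avoiding m x * A x l)
  avoiding-suc-≢ m {l} l≢v with l ≟ v
  ... | yes l≡v = ⊥-elim (l≢v l≡v)
  ... | no  _   = refl

  -- firstReturn m is the weight of the closed walks at v of length m + 1 meeting v only at their ends.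
  firstReturn : ℕ → ℕ
  firstReturn m = sumFin (λ x → avoiding m x * A x v)

  -- Split a walk from v at its last visit to v.
  matPow-last-visit : ∀ n l → matPow A n v l ≡ conv f (λ m → avoiding m l) n
  matPow-last-visit zero    l = sym (trans (cong (_* identity v l) f-0) (+-identityʳ (identity v l)))
  matPow-last-visit (suc n) l = by-cases (l ≟ v)
    where
    open ≡-Reasoning
    Goal : Fin k → Set
    Goal l = matPow A (suc n) v l ≡ conv f (λ m → avoiding m l) (suc n)
    at-v : Goal v
    at-v = sym (begin
      f (suc n) * identity v v + conv f (λ m → avoiding (suc m) v) n
        ≡⟨ cong₂ _+_ (cong (f (suc n) *_) f-0) (conv-zeroʳ f n avoiding-suc-v) ⟩
      f (suc n) * 1 + 0
        ≡⟨ trans (+-identityʳ _) (*-identityʳ _) ⟩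
      f (suc n)
        ∎)
    by-cases : Dec (l ≡ v) → Goal l
    by-cases (yes l≡v) = subst Goal (sym l≡v) at-v
    by-cases (no  l≢v) = begin
      sumFin (λ x → matPow A n v x * A x l)
        ≡⟨ sumFin-cong (λ x → cong (_* A x l) (matPow-last-visit n x)) ⟩
      sumFin (λ x → conv f (λ m → avoiding m x) n * A x l)
        ≡⟨ sumFin-conv f (λ x m → avoiding m x) (λ x → A x l) n ⟩
      conv f (λ m → sumFin (λ x → avoiding m x * A x l)) n
        ≡⟨ conv-congʳ f n (λ m → avoiding-suc-≢ m l≢v) ⟨
      conv f (λ m → avoiding (suc m) l) n
        ≡⟨ cong (_+ conv f (λ m → avoiding (suc m) l) n) v-off ⟨
      f (suc n) * identity v l + conv f (λ m → avoiding (suc m) l) n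
        ∎
      where
      v-off : f (suc n) * identity v l ≡ 0
      v-off = trans (cong (f (suc n) *_) (identity-offdiag (l≢v ∘ sym))) (*-zeroʳ (f (suc n)))

  f-suc-conv : ∀ n → f (suc n) ≡ conv f firstReturn n
  f-suc-conv n = trans (sumFin-cong (λ x → cong (_* A x v) (matPow-last-visit n x)))
                       (sumFin-conv f (λ x m → avoiding m x) (λ x → A x v) n)

  firstReturn-≤ : ∀ m → firstReturn m ≤ f (suc m)
  firstReturn-≤ m = begin
    firstReturn m                 ≡⟨ +-identityʳ (firstReturn m) ⟨
    1 * firstReturn m             ≡⟨ cong (_* firstReturn m) f-0 ⟨
    f 0 * firstReturn m           ≤⟨ ≤-conv f firstReturn 0 m ⟩
    conv f firstReturn (m + 0)    ≡⟨ cong (conv f firstReturn) (+-identityʳ m) ⟩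
    conv f firstReturn m          ≡⟨ f-suc-conv m ⟨
    f (suc m)                     ∎
    where open ≤-Reasoning

  module SingleCycle (f≤1 : ∀ n → f n ≤ 1) (p′ : ℕ) (1≤fp : 1 ≤ f (suc p′))
                     (below : ∀ {m} → m < p′ → ¬ 1 ≤ f (suc m)) where

    p = suc p′
    r = firstReturn

    f-gap : ∀ {t} → 0 < t → t < p → f t ≡ 0
    f-gap {suc t} _ (s≤s t<p′) = n<1⇒n≡0 (≰⇒> (below t<p′))

    r-p′ : r p′ ≡ 1
    r-p′ = begin
      r p′            ≡⟨ +-identityʳ (r p′) ⟨
      1 * r p′        ≡⟨ cong (_* r p′) f-0 ⟨
      f 0 * r p′      ≡⟨ conv-singleˡ f r p′ (λ _ 0<t t≤p′ → f-gap 0<t (s≤s t≤p′)) ⟨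
      conv f r p′     ≡⟨ f-suc-conv p′ ⟨
      f p             ≡⟨ ≤-antisym (f≤1 p) 1≤fp ⟩
      1               ∎
      where open ≡-Reasoning

    -- A closed walk of length p and a first return of length m + 1 concatenate in two orders.
    no-late-return : ∀ {m} → p′ < m → ¬ 1 ≤ r m
    no-late-return p′<m 1≤rm with d , refl ← m≤n⇒∃[o]m+o≡n p′<m =
      2≰1 (≤-trans two-walks (f≤1 (suc (p′ + (suc d + p)))))
      where
      2≰1 : ¬ 2 ≤ 1
      2≰1 (s≤s ())
      1≤r[p′+1+d] : 1 ≤ r (p′ + suc d)
      1≤r[p′+1+d] = subst (λ x → 1 ≤ r x) (sym (+-suc p′ d)) 1≤rm
      1≤f[1+d+p] : 1 ≤ f (suc d + p)
      1≤f[1+d+p] = ≤-trans (subst (λ x → 1 ≤ r x) (trans (cong suc (+-comm p′ d)) (sym (+-suc d p′))) 1≤rm)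
                           (firstReturn-≤ (d + p))
      two-walks : 2 ≤ f (suc (p′ + (suc d + p)))
      two-walks = begin
        1 + 1                                        ≤⟨ +-mono-≤ (*-mono-≤ 1≤fp 1≤r[p′+1+d])
                                                                 (*-mono-≤ 1≤f[1+d+p] (≤-reflexive (sym r-p′))) ⟩
        f p * r (p′ + suc d) + f (suc d + p) * r p′  ≤⟨ ≤-conv₂ f r p d p′ ⟩
        conv f r (p′ + (suc d + p))                  ≡⟨ f-suc-conv (p′ + (suc d + p)) ⟨
        f (suc (p′ + (suc d + p)))                   ∎
        where open ≤-Reasoning

    r-off : ∀ m → m ≢ p′ → r m ≡ 0
    r-off m m≢p′ with <-cmp m p′
    ... | tri< m<p′ _ _ = n≤0⇒n≡0 (≤-trans (firstReturn-≤ m) (≤-reflexive (f-gap (s≤s z≤n) (s≤s m<p′))))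
    ... | tri≈ _ m≡p′ _ = ⊥-elim (m≢p′ m≡p′)
    ... | tri> _ _ p′<m = n<1⇒n≡0 (≰⇒> (no-late-return p′<m))

    f-periodic : ∀ n → f (n + p) ≡ f n
    f-periodic n = begin
      f (n + suc p′)       ≡⟨ cong f (+-suc n p′) ⟩
      f (suc (n + p′))     ≡⟨ f-suc-conv (n + p′) ⟩
      conv f r (n + p′)    ≡⟨ cong (conv f r) (+-comm n p′) ⟩
      conv f r (p′ + n)    ≡⟨ conv-singleʳ f p′ n r-off ⟩
      f n * r p′           ≡⟨ cong (f n *_) r-p′ ⟩
      f n * 1              ≡⟨ *-identityʳ (f n) ⟩
      f n                  ∎
      where open ≡-Reasoning

  single-cycle : (∀ n → f n ≤ 1) → ∀ n → 1 ≤ f (suc n) →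
    Σ ℕ λ p → Σ (NonZero p) λ nz → ∀ n → f n ≡ ind p {{nz}} n
  single-cycle f≤1 n f-pos with p′ , 1≤fp , below ← least (λ n → 1 ≤? f (suc n)) {n} f-pos =
    suc p′ , _ , ind-periodic f (suc p′) f-0 f-gap f-periodic
    where open SingleCycle f≤1 p′ 1≤fp below

  S : ℕ → Set
  S n = 1 ≤ f n

  S-0 : S 0
  S-0 = ≤-reflexive (sym f-0)

  S-+ : ∀ x y → S x → S y → S (x + y)
  S-+ x y Sx Sy = ≤-trans (*-mono-≤ Sx Sy) (f-super x y)

  S-pair-descend : ∀ d a → S a → S (a + d) → Σ ℕ λ a′ → a′ < j × (S a′ × S (a′ + d))
  S-pair-descend d a Sa Sa+d = descend-f back a (Sa , Sa+d)
    where
    swap : ∀ t j d → t + j + d ≡ t + d + j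
    swap = solve-∀
    back : ∀ t → S (t + j) × S (t + j + d) → S (t + i) × S (t + i + d)
    back t (St+j , St+j+d) =
      sat-1≤ (sat-f-back t) St+j ,
      subst S (sym (swap t i d)) (sat-1≤ (sat-f-back (t + d)) (subst S (swap t j d) St+j+d))

  -- d is a difference of two elements of the support; bounding the smaller one by j keeps this
  -- decidable and loses nothing, by S-pair-descend.
  Gap : ℕ → Set
  Gap d = 0 < d × Σ ℕ λ a → a < j × (S a × S (a + d))

  Gap? : Decidable Gap
  Gap? d = (0 <? d) ×-dec anyUpTo? (λ a → (1 ≤? f a) ×-dec (1 ≤? f (a + d))) j

  2≤f⇒S : ∀ c → 2 ≤ f c → S c
  2≤f⇒S c = ≤-trans (s≤s z≤n)

  2≤f⇒0< : ∀ {c} → 2 ≤ f c → 0 < c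
  2≤f⇒0< {zero}  2≤f0 with s≤s () ← subst (2 ≤_) f-0 2≤f0
  2≤f⇒0< {suc c} _ = s≤s z≤n

  2≤f⇒Gap : ∀ c → 2 ≤ f c → Gap c
  2≤f⇒Gap c 2≤fc = 2≤f⇒0< 2≤fc , S-pair-descend c c Sc (S-+ c c Sc Sc)
    where Sc = 2≤f⇒S c 2≤fc

  exponential-case : ∀ c → 2 ≤ f c →
    Σ ℕ λ p → Σ (NonZero p) λ nz → Σ (ℕ → ℕ) λ g → Exp2Theta g × (∀ n → f n ≡ ind p {{nz}} n * g n)
  exponential-case c 2≤fc with p , (0<p , a , _ , Sa , Sa+p) , below ← least Gap? (2≤f⇒Gap c 2≤fc) =
    p , _ , ind-factor f p (2 * c) C (2 * (N + c)) (≤-trans 0<c (m≤m+n c (c + 0))) (s≤s z≤n) f-off f-bounds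
    where
    0<c = 2≤f⇒0< 2≤fc
    instance
      p≢0 = >-nonZero 0<p
    gap : ∀ x d → 0 < d → d < p → S x → S (x + d) → ⊥
    gap x d 0<d d<p Sx Sx+d = below d<p (0<d , S-pair-descend d x Sx Sx+d)
    open AdditiveSubmonoid S S-0 S-+
    open MinimalGap p gap a Sa Sa+p
    open Supermultiplicative f S-0 f-super
    N = proj₁ large-multiples
    f-off : ∀ {n} → ¬ p ∣ n → f n ≡ 0
    f-off ¬p∣n = n<1⇒n≡0 (≰⇒> (¬p∣n ∘ S⇒∣))
    f-bounds : ∀ {n} → 2 * (N + c) ≤ n → p ∣ n → 2 ^ n ≤ f n ^ (2 * c) × f n ≤ 2 ^ (C * n)
    f-bounds {n} le p∣n =
      exponential-lower-bound 0<c 2≤fc (S⇒∣ (2≤f⇒S c 2≤fc)) (proj₂ large-multiples) le p∣n , f-≤-2^ n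

  f-≤1 : ¬ (Σ ℕ λ n → n < j × 2 ≤ f n) → ∀ n → f n ≤ 1
  f-≤1 none-below n = ≤-pred (≰⇒> (none-below ∘ descend-f (λ t → sat-2≤ (sat-f-back t)) n))

  f-suc≡0 : ¬ (Σ ℕ λ n → n < j × 1 ≤ f (suc n)) → ∀ n → f (suc n) ≡ 0
  f-suc≡0 none-below n = n<1⇒n≡0 (≰⇒> (none-below ∘ descend-f (λ t → sat-1≤ (sat-f-back (suc t))) n))

  trichotomy : ((f 0 ≡ 1) × (∀ n → f (suc n) ≡ 0))
    ⊎ (Σ ℕ λ p → Σ (NonZero p) λ nz → ∀ n → f n ≡ ind p {{nz}} n)
    ⊎ (Σ ℕ λ p → Σ (NonZero p) λ nz → Σ (ℕ → ℕ) λ g → Exp2Theta g × (∀ n → f n ≡ ind p {{nz}} n * g n))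
  trichotomy with anyUpTo? (λ n → 2 ≤? f n) j | anyUpTo? (λ n → 1 ≤? f (suc n)) j
  ... | yes (c , _ , 2≤fc) | _                    = inj₂ (inj₂ (exponential-case c 2≤fc))
  ... | no  no-large       | yes (n , _ , 1≤fn+1) = inj₂ (inj₁ (single-cycle (f-≤1 no-large) n 1≤fn+1))
  ... | no  _              | no  no-return        = inj₁ (f-0 , f-suc≡0 no-return)

lemma23 : (k : ℕ) (A : Mat k) (v : Fin k) →
    let f = λ n → matPow A n v v in
    ((f 0 ≡ 1) × (∀ n → f (suc n) ≡ 0))
    ⊎ (Σ ℕ λ p → Σ (NonZero p) λ nz →
         ∀ n → f n ≡ ind p {{nz}} n)
    ⊎ (Σ ℕ λ p → Σ (NonZero p) λ nz → Σ (ℕ → ℕ) λ g →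
         Exp2Theta g × (∀ n → f n ≡ ind p {{nz}} n * g n))
lemma23 k A v = ClosedWalks.trichotomy A v
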